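{- For all sufficiently large $n$, \[\log_2\!\left(\frac{|A(n)|}{|F(n-1)|}\right)\le n+\log_2^2 n+\log_2 n-1,\] where $F(m)$ is the set of $I_3$-free digraphs on $\{0,\ldots,m-1\}$ and $A(n)=\{\Gamma\in F(n):\exists v\in\Gamma\ (|\Delta(v)|\le\log_2 n)\}$.
   Context: A digraph is a pair $(G,E)$ with $E\subseteq G\times G$ such that $(g,g)\notin E$ for all $g$, and $(g,g')\in E$ implies $(g',g)\notin E$; write $g\rightarrow g'$ for $(g,g')\in E$. It is $I_3$-free if every set of three distinct vertices spans at least one arrow. In a digraph, $x\not\sim y$ means $x\neq y$, $x\not\rightarrow y$ and $y\not\rightarrow x$, and $\Delta(v)=\{x: x\not\sim v\}$. Here $\log_2^2 n=(\log_2 n)^2$. -}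

module Defs where

open import Data.Bool using (Bool; true; false)
open import Data.Nat using (ℕ; zero; suc; _+_; _*_; _∸_; _^_; _≤_; _<_; _≥_)
open import Data.Fin using (Fin; zero; suc)
open import Data.Fin.Properties using (all?; any?) renaming (_≟_ to _≟ᶠ_)
open import Data.Bool.Properties renaming (_≟_ to _≟ᵇ_)
open import Data.List using (List; []; _∷_; [_]; concatMap; map; filter; length; allFin)
open import Data.Product using (_×_; ∃)
open import Data.Sum using (_⊎_)
open import Relation.Nullary using (¬_; Dec)
open import Relation.Nullary.Decidable using (_×-dec_; _⊎-dec_; ¬?; _→-dec_)
open import Relation.Binary.PropositionalEquality using (_≡_; _≢_)

extend : ∀ {A : Set} {k : ℕ} → A → (Fin k → A) → Fin (suc k) → A
extend a f zero = a
extend a f (suc i) = f i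

allFuns : ∀ {A : Set} → List A → (k : ℕ) → List (Fin k → A)
allFuns xs zero = [ (λ ()) ]
allFuns xs (suc k) = concatMap (λ f → map (λ a → extend a f) xs) (allFuns xs k)

-- A candidate arrow relation on the vertex set {0,…,m-1} = Fin m
-- (encoded as its characteristic function; each relation appears exactly once).
Rel : ℕ → Set
Rel m = Fin m → Fin m → Bool

allRel : (m : ℕ) → List (Rel m)
allRel m = allFuns (allFuns (false ∷ true ∷ []) m) m

Arrow : ∀ {m} → Rel m → Fin m → Fin m → Set
Arrow E g g' = E g g' ≡ true

arrow? : ∀ {m} (E : Rel m) (g g' : Fin m) → Dec (Arrow E g g')
arrow? E g g' = E g g' ≟ᵇ true

IsDigraph : ∀ {m} → Rel m → Set
IsDigraph E = (∀ g → ¬ Arrow E g g) × (∀ g g' → Arrow E g g' → ¬ Arrow E g' g)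

I3Free : ∀ {m} → Rel m → Set
I3Free E = ∀ x y z → x ≢ y → x ≢ z → y ≢ z →
  (Arrow E x y ⊎ Arrow E y x) ⊎ ((Arrow E x z ⊎ Arrow E z x) ⊎ (Arrow E y z ⊎ Arrow E z y))

isDigraph? : ∀ {m} (E : Rel m) → Dec (IsDigraph E)
isDigraph? E = all? (λ g → ¬? (arrow? E g g))
  ×-dec all? (λ g → all? (λ g' → arrow? E g g' →-dec ¬? (arrow? E g' g)))

i3Free? : ∀ {m} (E : Rel m) → Dec (I3Free E)
i3Free? E = all? λ x → all? λ y → all? λ z →
  ¬? (x ≟ᶠ y) →-dec (¬? (x ≟ᶠ z) →-dec (¬? (y ≟ᶠ z) →-dec
    ((arrow? E x y ⊎-dec arrow? E y x) ⊎-dec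
      ((arrow? E x z ⊎-dec arrow? E z x) ⊎-dec (arrow? E y z ⊎-dec arrow? E z y)))))

IsI3FreeDigraph : ∀ {m} → Rel m → Set
IsI3FreeDigraph E = IsDigraph E × I3Free E

isI3FreeDigraph? : ∀ {m} (E : Rel m) → Dec (IsI3FreeDigraph E)
isI3FreeDigraph? E = isDigraph? E ×-dec i3Free? E

F : (m : ℕ) → List (Rel m)
F m = filter isI3FreeDigraph? (allRel m)

NonAdj : ∀ {m} → Rel m → Fin m → Fin m → Set
NonAdj E x y = x ≢ y × (¬ Arrow E x y × ¬ Arrow E y x)

nonAdj? : ∀ {m} (E : Rel m) (x y : Fin m) → Dec (NonAdj E x y)
nonAdj? E x y = ¬? (x ≟ᶠ y) ×-dec (¬? (arrow? E x y) ×-dec ¬? (arrow? E y x))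

∣Δ∣ : ∀ {m} → Rel m → Fin m → ℕ
∣Δ∣ {m} E v = length (filter (λ x → nonAdj? E x v) (allFin m))

-- |Δ(v)| ≤ log₂ n  ⟺  2^|Δ(v)| ≤ n  (|Δ(v)| is a natural number)
SmallΔ : ∀ {n} → Rel n → Set
SmallΔ {n} E = ∃ λ (v : Fin n) → 2 ^ ∣Δ∣ E v ≤ n

smallΔ? : ∀ {n} (E : Rel n) → Dec (SmallΔ E)
smallΔ? {n} E = any? (λ v → 2 ^ ∣Δ∣ E v Data.Nat.≤? n)

A : (n : ℕ) → List (Rel n)
A n = filter smallΔ? (F n)

-- The real inequality  log₂(a / f) ≤ n + (log₂ n)² + log₂ n − 1   (a = |A(n)|, f = |F(n-1)|)
-- is equivalent (for n ≥ 2, f > 0) to  2a / (f·2ⁿ·n) ≤ n^(log₂ n), i.e. to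
-- 2a/(f·2ⁿ·n) ≤ n^(p/q) for every rational p/q > log₂ n (⟺ n^q < 2^p),
-- i.e. (2a)^q ≤ (f·2ⁿ·n)^q · n^p.  Stated without real numbers:
LogBound : (n a f : ℕ) → Set
LogBound n a f = ∀ (p q : ℕ) → 1 ≤ q → n ^ q < 2 ^ p →
  (2 * a) ^ q ≤ (f * 2 ^ n * n) ^ q * n ^ p

{-# OPTIONS --safe #-}
-- A digraph Γ ∈ A(n) is recovered from four pieces of data: a vertex v with |Δ(v)| ≤ ⌊log₂ n⌋, the
-- I₃-free digraph Γ − v on the remaining n − 1 vertices, a sequence of ⌊log₂ n⌋ vertices whose
-- entries are v or non-neighbours of v and which contains all of Δ(v), and one bit for each vertex
-- u ≠ v.  The bit gives the direction of the arrow between u and v, and there is exactly one such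
-- arrow unless u ∈ Δ(v).  Hence |A(n)| ≤ n · |F(n−1)| · n^⌊log₂ n⌋ · 2^(n−1), and taking base-2
-- logarithms gives the bound because ⌊log₂ n⌋ · log₂ n ≤ log₂² n.

module Submission where

open import Defs
open import Data.Nat using (ℕ; _∸_; _≥_)
open import Data.List using (length)
open import Data.Product using (∃)

open import Level using (0ℓ)
open import Data.Bool using (Bool; true; false; not; _∧_)
open import Data.Bool.Properties using (¬-not; not-¬)
open import Data.Fin using (Fin; zero; suc; punchIn; punchOut)
open import Data.Fin.Properties using (any?; punchIn-punchOut; punchIn-injective; injective⇒≤)
  renaming (_≟_ to _≟ᶠ_)
open import Data.List
  using (List; []; _∷_; _++_; map; filter; lookup; concatMap; allFin; cartesianProduct; cartesianProductWith)
open import Data.List.Properties using (length-++; length-map; length-tabulate)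
open import Data.List.Membership.Propositional using () renaming (_∈_ to _∈ₚ_)
open import Data.List.Membership.Propositional.Properties using (∈-lookup; ∈-allFin; ∈-filter⁻)
  renaming (∈-filter⁺ to ∈ₚ-filter⁺)
import Data.List.Membership.Setoid as SetoidMembership
open import Data.List.Membership.Setoid.Properties
  using (index-injective; ∈-resp-≈; ∈-cartesianProductWith⁺; ∈-cartesianProduct⁺; ∈-filter⁺)
open import Data.List.Relation.Unary.All as All using (All; []; _∷_)
open import Data.List.Relation.Unary.AllPairs using ([]; _∷_)
open import Data.List.Relation.Unary.Any as Any using (here; there; index)
open import Data.List.Relation.Unary.Any.Properties using (map⁺)
open import Data.List.Relation.Unary.Enumerates.Setoid using (IsEnumeration)
open import Data.List.Relation.Unary.Unique.Setoid using (Unique)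
open import Data.List.Relation.Unary.Unique.Setoid.Properties using (cartesianProductWith⁺; filter⁺)
open import Data.Nat
  using (suc; zero; _+_; _*_; _^_; _≤_; _<_; z≤n; s≤s; NonZero; >-nonZero; ⌊_/2⌋; ⌈_/2⌉)
open import Data.Nat.Induction using (<-wellFounded)
open import Data.Nat.Logarithm using (⌊log₂_⌋; ⌊log₂⌋-mono-≤; ⌊log₂[2^n]⌋≡n)
open import Data.Nat.Logarithm.Core using (⌊log2⌋)
open import Data.Nat.Properties
open import Data.Nat.Solver using (module +-*-Solver)
open import Data.Product using (_×_; _,_; proj₁; proj₂)
open import Data.Product.Relation.Binary.Pointwise.NonDependent using (_×ₛ_)
open import Data.Sum using (_⊎_; inj₁; inj₂)
import Data.Sum as Sum
open import Function using (_∘_; id)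
open import Function.Definitions using (Injective)
open import Function.Indexed.Relation.Binary.Equality using (≡-setoid)
open import Induction.WellFounded using (Acc; acc)
open import Relation.Binary.Bundles using (Setoid)
import Relation.Binary.Indexed.Heterogeneous.Construct.Trivial as Trivial
open import Relation.Binary.PropositionalEquality
  using (_≡_; _≢_; _≗_; refl; sym; trans; cong; cong₂; subst; module ≡-Reasoning)
import Relation.Binary.PropositionalEquality.Properties as ≡
open import Relation.Nullary using (¬_; yes; no; does; contradiction)

infixr 9 _⟶ₛ_
_⟶ₛ_ : ∀ {ℓ} → Set → Setoid 0ℓ ℓ → Setoid 0ℓ ℓ
I ⟶ₛ S = ≡-setoid I (Trivial.indexedSetoid S)

module _ {ℓ} (S : Setoid 0ℓ ℓ) where
  open Setoid S using (_≈_) renaming (sym to ≈-sym)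
  open SetoidMembership S using (_∈_)

  Unique⇒lookup-injective : ∀ {xs} → Unique S xs → ∀ {i j} → lookup xs i ≈ lookup xs j → i ≡ j
  Unique⇒lookup-injective (_ ∷ _) {zero} {zero} _ = refl
  Unique⇒lookup-injective (x≉xs ∷ _) {zero} {suc j} x≈ =
    contradiction x≈ (All.lookup x≉xs (∈-lookup j))
  Unique⇒lookup-injective (x≉xs ∷ _) {suc i} {zero} ≈x =
    contradiction (≈-sym ≈x) (All.lookup x≉xs (∈-lookup i))
  Unique⇒lookup-injective (_ ∷ xs!) {suc i} {suc j} eq = cong suc (Unique⇒lookup-injective xs! eq)

  Unique-All∈⇒length≤ : ∀ {xs ys} → Unique S xs → All (_∈ ys) xs → length xs ≤ length ys
  Unique-All∈⇒length≤ {xs} {ys} xs! xs⊆ys = injective⇒≤ position-injective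
    where
    position : Fin (length xs) → Fin (length ys)
    position i = index (All.lookup xs⊆ys (∈-lookup i))

    position-injective : Injective _≡_ _≡_ position
    position-injective eq = Unique⇒lookup-injective xs! (index-injective S _ _ eq)

concatMap-map≡cartesianProductWith : ∀ {A B C : Set} (f : A → B → C) xs ys →
  concatMap (λ x → map (f x) ys) xs ≡ cartesianProductWith f xs ys
concatMap-map≡cartesianProductWith f [] ys = refl
concatMap-map≡cartesianProductWith f (x ∷ xs) ys =
  cong (map (f x) ys ++_) (concatMap-map≡cartesianProductWith f xs ys)

length-cartesianProductWith : ∀ {A B C : Set} (f : A → B → C) xs ys →
  length (cartesianProductWith f xs ys) ≡ length xs * length ys
length-cartesianProductWith f [] ys = refl
length-cartesianProductWith f (x ∷ xs) ys = trans (length-++ (map (f x) ys))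
  (cong₂ _+_ (length-map (f x) ys) (length-cartesianProductWith f xs ys))

length-cartesianProduct : ∀ {A B : Set} (xs : List A) (ys : List B) →
  length (cartesianProduct xs ys) ≡ length xs * length ys
length-cartesianProduct = length-cartesianProductWith _,_

allFuns-suc : ∀ {A : Set} (xs : List A) k →
  allFuns xs (suc k) ≡ cartesianProductWith (λ f a → extend a f) (allFuns xs k) xs
allFuns-suc xs k = concatMap-map≡cartesianProductWith (λ f a → extend a f) (allFuns xs k) xs

length-allFuns : ∀ {A : Set} (xs : List A) k → length (allFuns xs k) ≡ length xs ^ k
length-allFuns xs zero = refl
length-allFuns xs (suc k) = begin
  length (allFuns xs (suc k))                        ≡⟨ cong length (allFuns-suc xs k) ⟩
  length (cartesianProductWith _ (allFuns xs k) xs)  ≡⟨ length-cartesianProductWith _ (allFuns xs k) xs ⟩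
  length (allFuns xs k) * length xs                  ≡⟨ cong (_* length xs) (length-allFuns xs k) ⟩
  length xs ^ k * length xs                          ≡⟨ *-comm (length xs ^ k) (length xs) ⟩
  length xs ^ suc k                                  ∎
  where open ≡-Reasoning

module _ {ℓ} (S : Setoid 0ℓ ℓ) where
  open Setoid S using (_≈_) renaming (refl to ≈-refl)

  extend-cong : ∀ {k a a′} {f f′ : Fin k → Setoid.Carrier S} →
    (∀ i → f i ≈ f′ i) → a ≈ a′ → ∀ i → extend a f i ≈ extend a′ f′ i
  extend-cong f≈f′ a≈a′ zero = a≈a′
  extend-cong f≈f′ a≈a′ (suc i) = f≈f′ i

  extend-injective : ∀ {k a a′} {f f′ : Fin k → Setoid.Carrier S} →
    (∀ i → extend a f i ≈ extend a′ f′ i) → (∀ i → f i ≈ f′ i) × a ≈ a′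
  extend-injective eq = eq ∘ suc , eq zero

  allFuns-isEnumeration : ∀ {xs} → IsEnumeration S xs →
    ∀ k → IsEnumeration (Fin k ⟶ₛ S) (allFuns xs k)
  allFuns-isEnumeration xs-enum zero f = here λ ()
  allFuns-isEnumeration {xs} xs-enum (suc k) f =
    subst (SetoidMembership._∈_ (Fin (suc k) ⟶ₛ S) f) (sym (allFuns-suc xs k))
      (∈-resp-≈ (Fin (suc k) ⟶ₛ S) extend≈f
        (∈-cartesianProductWith⁺ (Fin k ⟶ₛ S) S (Fin (suc k) ⟶ₛ S) extend-cong
          (allFuns-isEnumeration xs-enum k (f ∘ suc)) (xs-enum (f zero))))
    where
    extend≈f : ∀ i → extend (f zero) (f ∘ suc) i ≈ f i
    extend≈f zero = ≈-refl
    extend≈f (suc i) = ≈-refl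

  allFuns-unique : ∀ {xs} → Unique S xs → ∀ k → Unique (Fin k ⟶ₛ S) (allFuns xs k)
  allFuns-unique xs! zero = [] ∷ []
  allFuns-unique {xs} xs! (suc k) = subst (Unique (Fin (suc k) ⟶ₛ S)) (sym (allFuns-suc xs k))
    (cartesianProductWith⁺ (Fin k ⟶ₛ S) S (Fin (suc k) ⟶ₛ S) _ extend-injective
      (allFuns-unique xs! k) xs!)

Rel-setoid : ℕ → Setoid 0ℓ 0ℓ
Rel-setoid m = Fin m ⟶ₛ Fin m ⟶ₛ ≡.setoid Bool

open module RelMembership {m} = SetoidMembership (Rel-setoid m) using () renaming (_∈_ to _∈ᴿ_)

_≈ᴿ_ : ∀ {m} → Rel m → Rel m → Set
E ≈ᴿ E′ = ∀ i j → E i j ≡ E′ i j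

booleans-isEnumeration : IsEnumeration (≡.setoid Bool) (false ∷ true ∷ [])
booleans-isEnumeration false = here refl
booleans-isEnumeration true = there (here refl)

booleans-unique : Unique (≡.setoid Bool) (false ∷ true ∷ [])
booleans-unique = ((λ ()) ∷ []) ∷ [] ∷ []

allRel-isEnumeration : ∀ m → IsEnumeration (Rel-setoid m) (allRel m)
allRel-isEnumeration m = allFuns-isEnumeration (Fin m ⟶ₛ ≡.setoid Bool)
  (allFuns-isEnumeration (≡.setoid Bool) booleans-isEnumeration m) m

allRel-unique : ∀ m → Unique (Rel-setoid m) (allRel m)
allRel-unique m = allFuns-unique (Fin m ⟶ₛ ≡.setoid Bool)
  (allFuns-unique (≡.setoid Bool) booleans-unique m) m

module _ {m} {E E′ : Rel m} (E≈E′ : E ≈ᴿ E′) where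

  Arrow-resp : ∀ {x y} → Arrow E x y → Arrow E′ x y
  Arrow-resp {x} {y} = trans (sym (E≈E′ x y))

  Arrow-resp⁻ : ∀ {x y} → Arrow E′ x y → Arrow E x y
  Arrow-resp⁻ {x} {y} = trans (E≈E′ x y)

  IsI3FreeDigraph-resp : IsI3FreeDigraph E → IsI3FreeDigraph E′
  IsI3FreeDigraph-resp ((irrefl , asym) , i3Free) =
    ( (λ g → irrefl g ∘ Arrow-resp⁻)
    , (λ g g′ g→g′ g′→g → asym g g′ (Arrow-resp⁻ g→g′) (Arrow-resp⁻ g′→g)) ) ,
    λ x y z x≢y x≢z y≢z →
      Sum.map (Sum.map Arrow-resp Arrow-resp)
        (Sum.map (Sum.map Arrow-resp Arrow-resp) (Sum.map Arrow-resp Arrow-resp))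
        (i3Free x y z x≢y x≢z y≢z)

∈-F⁺ : ∀ {m} {E : Rel m} → IsI3FreeDigraph E → E ∈ᴿ F m
∈-F⁺ {m} {E} =
  ∈-filter⁺ (Rel-setoid m) isI3FreeDigraph? IsI3FreeDigraph-resp (allRel-isEnumeration m E)

A-unique : ∀ n → Unique (Rel-setoid n) (A n)
A-unique n = filter⁺ (Rel-setoid n) smallΔ? (filter⁺ (Rel-setoid n) isI3FreeDigraph? (allRel-unique n))

∈-A⁻ : ∀ {n} {E : Rel n} → E ∈ₚ A n → IsI3FreeDigraph E × SmallΔ E
∈-A⁻ {n} E∈A with E∈F , small ← ∈-filter⁻ smallΔ? {xs = F n} E∈A =
  proj₂ (∈-filter⁻ isI3FreeDigraph? {xs = allRel n} E∈F) , small

removeVertex : ∀ {m} → Fin (suc m) → Rel (suc m) → Rel m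
removeVertex v E a c = E (punchIn v a) (punchIn v c)

removeVertex-IsI3FreeDigraph : ∀ {m} (v : Fin (suc m)) {E : Rel (suc m)} →
  IsI3FreeDigraph E → IsI3FreeDigraph (removeVertex v E)
removeVertex-IsI3FreeDigraph v ((irrefl , asym) , i3Free) =
  ((λ g → irrefl (punchIn v g)) , (λ g g′ → asym (punchIn v g) (punchIn v g′))) ,
  λ x y z x≢y x≢z y≢z → i3Free (punchIn v x) (punchIn v y) (punchIn v z)
    (x≢y ∘ punchIn-injective v x y) (x≢z ∘ punchIn-injective v x z) (y≢z ∘ punchIn-injective v y z)

pad : ∀ {X : Set} {L} → X → (xs : List X) → length xs ≤ L → Fin L → X
pad d [] _ _ = d
pad d (x ∷ xs) (s≤s _) zero = x
pad d (x ∷ xs) (s≤s xs≤L) (suc k) = pad d xs xs≤L k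

module _ {X : Set} (d : X) where

  pad-sound : ∀ {L} xs (xs≤L : length xs ≤ L) k →
    pad d xs xs≤L k ≡ d ⊎ pad d xs xs≤L k ∈ₚ xs
  pad-sound [] _ _ = inj₁ refl
  pad-sound (x ∷ xs) (s≤s _) zero = inj₂ (here refl)
  pad-sound (x ∷ xs) (s≤s xs≤L) (suc k) = Sum.map₂ there (pad-sound xs xs≤L k)

  pad-complete : ∀ {L x} xs (xs≤L : length xs ≤ L) → x ∈ₚ xs → ∃ λ k → pad d xs xs≤L k ≡ x
  pad-complete (_ ∷ _) (s≤s _) (here refl) = zero , refl
  pad-complete (_ ∷ xs) (s≤s xs≤L) (there x∈xs)
    with k , eq ← pad-complete xs xs≤L x∈xs = suc k , eq

Δ : ∀ {n} → Rel n → Fin n → List (Fin n)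
Δ {n} E v = filter (λ x → nonAdj? E x v) (allFin n)

module _ {n} (E : Rel n) {v x : Fin n} where

  ∈-Δ⁺ : NonAdj E x v → x ∈ₚ Δ E v
  ∈-Δ⁺ = ∈ₚ-filter⁺ (λ x → nonAdj? E x v) (∈-allFin x)

  ∈-Δ⁻ : x ∈ₚ Δ E v → NonAdj E x v
  ∈-Δ⁻ = proj₂ ∘ ∈-filter⁻ (λ x → nonAdj? E x v) {xs = allFin n}

record ListsΔ {n L} (E : Rel n) (v : Fin n) (t : Fin L → Fin n) : Set where
  field
    complete : ∀ {x} → NonAdj E x v → ∃ λ k → t k ≡ x
    sound : ∀ k → t k ≡ v ⊎ NonAdj E (t k) v

  listed⇒NonAdj : ∀ {k x} → v ≢ x → t k ≡ x → NonAdj E x v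
  listed⇒NonAdj {k} v≢x refl with sound k
  ... | inj₁ tk≡v = contradiction (sym tk≡v) v≢x
  ... | inj₂ nonAdj = nonAdj

ListsΔ-resp : ∀ {n L} {E : Rel n} {v} {t t′ : Fin L → Fin n} →
  t ≗ t′ → ListsΔ E v t → ListsΔ E v t′
ListsΔ-resp {E = E} {v} t≗t′ t-lists = record
  { complete = λ nonAdj → let k , tk≡x = complete nonAdj in k , trans (sym (t≗t′ k)) tk≡x
  ; sound = λ k → subst (λ y → y ≡ v ⊎ NonAdj E y v) (t≗t′ k) (sound k)
  }
  where open ListsΔ t-lists

pad-ListsΔ : ∀ {n L} (E : Rel n) v (Δ≤L : length (Δ E v) ≤ L) → ListsΔ E v (pad v (Δ E v) Δ≤L)
pad-ListsΔ E v Δ≤L = record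
  { complete = pad-complete v (Δ E v) Δ≤L ∘ ∈-Δ⁺ E
  ; sound = Sum.map₂ (∈-Δ⁻ E) ∘ pad-sound v (Δ E v) Δ≤L
  }

adjacent⇒arrow≡not-reverse : ∀ {n} {E : Rel n} → IsDigraph E →
  ∀ {x y} → x ≢ y → ¬ NonAdj E x y → E x y ≡ not (E y x)
adjacent⇒arrow≡not-reverse {E = E} (_ , asym) {x} {y} x≢y adjacent with E x y in x→y
... | true = ¬-not λ true≡E[y,x] → asym x y x→y (sym true≡E[y,x])
... | false = ¬-not λ false≡E[y,x] → adjacent (x≢y , (λ ()) , not-¬ (sym false≡E[y,x]))

-- (v , Γ − v , t , out): t lists Δ(v), padded with v, and out u says whether v → u.
Code : ℕ → ℕ → Set
Code m L = Fin (suc m) × Rel m × (Fin L → Fin (suc m)) × (Fin m → Bool)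

listed : ∀ {n L} → (Fin L → Fin n) → Fin n → Bool
listed t x = does (any? λ k → t k ≟ᶠ x)

decode : ∀ {m L} → Code m L → Rel (suc m)
decode (v , E′ , t , out) i j with v ≟ᶠ i | v ≟ᶠ j
... | yes _   | yes _   = false
... | yes _   | no v≢j = not (listed t j) ∧ out (punchOut v≢j)
... | no v≢i | yes _   = not (listed t i) ∧ not (out (punchOut v≢i))
... | no v≢i | no v≢j = E′ (punchOut v≢i) (punchOut v≢j)

outArrows : ∀ {m} → Rel (suc m) → Fin (suc m) → Fin m → Bool
outArrows E v a = E v (punchIn v a)

module _ {m L} {E : Rel (suc m)} (E-digraph : IsDigraph E)
         {v E′} {t : Fin L → Fin (suc m)} {out}
         (E-v≈E′ : removeVertex v E ≈ᴿ E′) (t-lists : ListsΔ E v t) (out≗ : outArrows E v ≗ out)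
         where
  open ListsΔ t-lists

  private
    arrow-from-centre≡out : ∀ {j} (v≢j : v ≢ j) → E v j ≡ out (punchOut v≢j)
    arrow-from-centre≡out v≢j =
      trans (cong (E v) (sym (punchIn-punchOut v≢j))) (out≗ (punchOut v≢j))

    arrow-from-centre : ∀ {j} (v≢j : v ≢ j) → E v j ≡ not (listed t j) ∧ out (punchOut v≢j)
    arrow-from-centre {j} v≢j with any? (λ k → t k ≟ᶠ j)
    ... | yes (_ , tk≡j) = ¬-not (proj₂ (proj₂ (listed⇒NonAdj v≢j tk≡j)))
    ... | no _ = arrow-from-centre≡out v≢j

    arrow-to-centre : ∀ {i} (v≢i : v ≢ i) → E i v ≡ not (listed t i) ∧ not (out (punchOut v≢i))
    arrow-to-centre {i} v≢i with any? (λ k → t k ≟ᶠ i)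
    ... | yes (_ , tk≡i) = ¬-not (proj₁ (proj₂ (listed⇒NonAdj v≢i tk≡i)))
    ... | no unlisted =
      trans (adjacent⇒arrow≡not-reverse E-digraph (v≢i ∘ sym) (unlisted ∘ complete))
            (cong not (arrow-from-centre≡out v≢i))

  decode-correct : E ≈ᴿ decode (v , E′ , t , out)
  decode-correct i j with v ≟ᶠ i | v ≟ᶠ j
  ... | yes refl | yes refl = ¬-not (proj₁ E-digraph v)
  ... | yes refl | no v≢j = arrow-from-centre v≢j
  ... | no v≢i | yes refl = arrow-to-centre v≢i
  ... | no v≢i | no v≢j =
    trans (cong₂ E (sym (punchIn-punchOut v≢i)) (sym (punchIn-punchOut v≢j))) (E-v≈E′ _ _)

Code-setoid : ℕ → ℕ → Setoid 0ℓ 0ℓ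
Code-setoid m L = ≡.setoid (Fin (suc m)) ×ₛ
  (Rel-setoid m ×ₛ (Fin L ⟶ₛ ≡.setoid (Fin (suc m)) ×ₛ Fin m ⟶ₛ ≡.setoid Bool))

open module CodeMembership {m L} = SetoidMembership (Code-setoid m L) using () renaming (_∈_ to _∈ᶜ_)

codes : ∀ m L → List (Code m L)
codes m L = cartesianProduct (allFin (suc m)) (cartesianProduct (F m)
  (cartesianProduct (allFuns (allFin (suc m)) L) (allFuns (false ∷ true ∷ []) m)))

length-codes : ∀ m L → length (codes m L) ≡ suc m * (length (F m) * (suc m ^ L * 2 ^ m))
length-codes m L = begin
  length (codes m L)
    ≡⟨ length-cartesianProduct (allFin (suc m)) (cartesianProduct (F m) (cartesianProduct ts outs)) ⟩
  length (allFin (suc m)) * length (cartesianProduct (F m) (cartesianProduct ts outs))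
    ≡⟨ cong₂ _*_ length-allFin (length-cartesianProduct (F m) (cartesianProduct ts outs)) ⟩
  suc m * (length (F m) * length (cartesianProduct ts outs))
    ≡⟨ cong (λ x → suc m * (length (F m) * x)) (length-cartesianProduct ts outs) ⟩
  suc m * (length (F m) * (length ts * length outs))
    ≡⟨ cong₂ (λ x y → suc m * (length (F m) * (x * y)))
         (trans (length-allFuns (allFin (suc m)) L) (cong (_^ L) length-allFin))
         (length-allFuns (false ∷ true ∷ []) m) ⟩
  suc m * (length (F m) * (suc m ^ L * 2 ^ m)) ∎
  where
  open ≡-Reasoning
  ts = allFuns (allFin (suc m)) L
  outs = allFuns (false ∷ true ∷ []) m
  length-allFin = length-tabulate {n = suc m} id

∈-codes⁺ : ∀ {m L} v {E′ : Rel m} t out → IsI3FreeDigraph E′ → (v , E′ , t , out) ∈ᶜ codes m L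
∈-codes⁺ {m} {L} v t out E′-ok =
  ∈-cartesianProduct⁺ (≡.setoid _) (Rel-setoid m ×ₛ (Ts ×ₛ Outs)) (∈-allFin v)
    (∈-cartesianProduct⁺ (Rel-setoid m) (Ts ×ₛ Outs) (∈-F⁺ E′-ok)
      (∈-cartesianProduct⁺ Ts Outs
        (allFuns-isEnumeration (≡.setoid _) ∈-allFin L t)
        (allFuns-isEnumeration (≡.setoid Bool) booleans-isEnumeration m out)))
  where
  Ts = Fin L ⟶ₛ ≡.setoid (Fin (suc m))
  Outs = Fin m ⟶ₛ ≡.setoid Bool

A⊆decode[codes] : ∀ m L → (∀ {k} → 2 ^ k ≤ suc m → k ≤ L) →
  All (_∈ᴿ map decode (codes m L)) (A (suc m))
A⊆decode[codes] m L ≤L = All.tabulate λ {E} E∈A →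
  let E-ok , v , 2^Δ≤n = ∈-A⁻ E∈A
      Δ≤L = ≤L 2^Δ≤n
  in map⁺ (Any.map (λ { (refl , E-v≈E′ , t≗t′ , out≗out′) →
            decode-correct (proj₁ E-ok) E-v≈E′ (ListsΔ-resp t≗t′ (pad-ListsΔ E v Δ≤L)) out≗out′ })
          (∈-codes⁺ v (pad v (Δ E v) Δ≤L) (outArrows E v) (removeVertex-IsI3FreeDigraph v E-ok)))

length-A≤ : ∀ m L → (∀ {k} → 2 ^ k ≤ suc m → k ≤ L) →
  length (A (suc m)) ≤ suc m * (length (F m) * (suc m ^ L * 2 ^ m))
length-A≤ m L ≤L = begin
  length (A (suc m))
    ≤⟨ Unique-All∈⇒length≤ (Rel-setoid (suc m)) (A-unique (suc m)) (A⊆decode[codes] m L ≤L) ⟩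
  length (map decode (codes m L))
    ≡⟨ length-map decode (codes m L) ⟩
  length (codes m L)
    ≡⟨ length-codes m L ⟩
  suc m * (length (F m) * (suc m ^ L * 2 ^ m)) ∎
  where open ≤-Reasoning

2*⌊n/2⌋≤n : ∀ n → 2 * ⌊ n /2⌋ ≤ n
2*⌊n/2⌋≤n n = begin
  2 * ⌊ n /2⌋         ≡⟨ cong (⌊ n /2⌋ +_) (+-identityʳ ⌊ n /2⌋) ⟩
  ⌊ n /2⌋ + ⌊ n /2⌋   ≤⟨ +-monoʳ-≤ ⌊ n /2⌋ (⌊n/2⌋≤⌈n/2⌉ n) ⟩
  ⌊ n /2⌋ + ⌈ n /2⌉   ≡⟨ ⌊n/2⌋+⌈n/2⌉≡n n ⟩
  n                   ∎
  where open ≤-Reasoning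

2^⌊log2⌋[1+n]≤1+n : ∀ n (rec : Acc _<_ (suc n)) → 2 ^ ⌊log2⌋ (suc n) rec ≤ suc n
2^⌊log2⌋[1+n]≤1+n zero _ = ≤-refl
2^⌊log2⌋[1+n]≤1+n (suc n) (acc rs) =
  ≤-trans (*-monoʳ-≤ 2 (2^⌊log2⌋[1+n]≤1+n ⌊ n /2⌋ _)) (2*⌊n/2⌋≤n (suc (suc n)))

2^⌊log₂n⌋≤n : ∀ n .{{_ : NonZero n}} → 2 ^ ⌊log₂ n ⌋ ≤ n
2^⌊log₂n⌋≤n (suc n) = 2^⌊log2⌋[1+n]≤1+n n (<-wellFounded (suc n))

2^k≤n⇒k≤⌊log₂n⌋ : ∀ {k n} → 2 ^ k ≤ n → k ≤ ⌊log₂ n ⌋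
2^k≤n⇒k≤⌊log₂n⌋ {k} {n} 2^k≤n =
  subst (_≤ ⌊log₂ n ⌋) (⌊log₂[2^n]⌋≡n k) (⌊log₂⌋-mono-≤ 2^k≤n)

*-distribʳ-^ : ∀ m n o → (m * n) ^ o ≡ m ^ o * n ^ o
*-distribʳ-^ m n zero = refl
*-distribʳ-^ m n (suc o) =
  trans (cong (m * n *_) (*-distribʳ-^ m n o)) ([m*n]*[o*p]≡[m*o]*[n*p] m n (m ^ o) (n ^ o))

LogBound-intro : ∀ {n} a f L → 2 ^ L ≤ n → 2 * a ≤ f * 2 ^ n * n * n ^ L → LogBound n a f
LogBound-intro {n} a f L 2^L≤n 2a≤ p q _ n^q<2^p = begin
  (2 * a) ^ q         ≤⟨ ^-monoˡ-≤ q 2a≤ ⟩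
  (X * n ^ L) ^ q     ≡⟨ *-distribʳ-^ X (n ^ L) q ⟩
  X ^ q * (n ^ L) ^ q ≡⟨ cong (X ^ q *_) (^-*-assoc n L q) ⟩
  X ^ q * n ^ (L * q) ≤⟨ *-monoʳ-≤ (X ^ q) (^-monoʳ-≤ n {{n≢0}} L*q≤p) ⟩
  X ^ q * n ^ p       ∎
  where
  open ≤-Reasoning
  X = f * 2 ^ n * n
  n≢0 : NonZero n
  n≢0 = >-nonZero (≤-trans (m^n>0 2 L) 2^L≤n)
  L*q≤p : L * q ≤ p
  L*q≤p = ≮⇒≥ λ p<L*q → <-irrefl refl (begin-strict
    2 ^ p        <⟨ ^-monoʳ-< 2 (s≤s (s≤s z≤n)) p<L*q ⟩
    2 ^ (L * q)  ≡⟨ ^-*-assoc 2 L q ⟨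
    (2 ^ L) ^ q  ≤⟨ ^-monoˡ-≤ q 2^L≤n ⟩
    n ^ q        <⟨ n^q<2^p ⟩
    2 ^ p        ∎)

2*|A|≤ : ∀ m → 2 * length (A (suc m)) ≤ length (F m) * 2 ^ suc m * suc m * suc m ^ ⌊log₂ suc m ⌋
2*|A|≤ m = begin
  2 * length (A (suc m))          ≤⟨ *-monoʳ-≤ 2 (length-A≤ m L 2^k≤n⇒k≤⌊log₂n⌋) ⟩
  2 * (n * (f * (n ^ L * 2 ^ m))) ≡⟨ solve 4 (λ n f nᴸ 2ᵐ →
                                       con 2 :* (n :* (f :* (nᴸ :* 2ᵐ)))
                                         := f :* (con 2 :* 2ᵐ) :* n :* nᴸ)
                                       refl n f (n ^ L) (2 ^ m) ⟩
  f * 2 ^ suc m * n * n ^ L       ∎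
  where
  open ≤-Reasoning
  open +-*-Solver using (solve; con; _:*_; _:=_)
  n = suc m
  f = length (F m)
  L = ⌊log₂ n ⌋

mainTheorem7 : ∃ λ (N : ℕ) → ∀ (n : ℕ) → n ≥ N →
    LogBound n (length (A n)) (length (F (n ∸ 1)))
mainTheorem7 = 1 , λ where
  (suc m) _ → LogBound-intro (length (A (suc m))) (length (F m)) ⌊log₂ suc m ⌋
    (2^⌊log₂n⌋≤n (suc m)) (2*|A|≤ m)
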